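{- Let $p$ and $q$ be distinct primes, let $P$ be a finite $p$-group, let $s$ be a nonnegative integer, and let $\phi:P\to\mathrm{Aut}(\mathbb{Z}_{q^s})$ be a homomorphism. Then the (undirected) $\{p\}$-excluded power graph $\mathcal{P}_{ -\{p\}}(\mathbb{Z}_{q^s}\rtimes_\phi P)$ is a disjoint union of cliques.
   Context: The outer semidirect product $\mathbb{Z}_{q^s}\rtimes_\phi P$ has underlying set $\mathbb{Z}_{q^s}\times P$ with multiplication $(a,b)(a',b')=(a+\phi_b(a'),bb')$. For a group $G$ and a set $\mathcal{X}$ of positive integers, the undirected $\mathcal{X}$-excluded power graph $\mathcal{P}_{ -\mathcal{X}}(G)$ has vertex set $G$ and an edge between distinct $g,h$ whenever $h=g^k$ or $g=h^k$ for some positive integer $k$ not divisible by any element of $\mathcal{X}$. A disjoint union of cliques means the vertex set is partitioned into sets, each inducing a complete graph, with no edges between different sets. -}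

module Defs where

open import Data.Nat using (ℕ; zero; suc; _+_; _^_; _>_)
open import Data.Nat.DivMod using (_mod_)
open import Data.Nat.Divisibility using (_∣_)
open import Data.Fin using (Fin; toℕ)
open import Data.Product using (Σ; ∃; _×_; _,_)
open import Data.Sum using (_⊎_)
open import Relation.Nullary using (¬_)
open import Relation.Binary.PropositionalEquality using (_≡_; _≢_)
open import Function.Bundles using (_⇔_)
open import Function.Definitions using (Bijective)
open import Algebra.Core using (Op₂)

_+ₙ_ : ∀ {n} → Fin n → Fin n → Fin n
_+ₙ_ {suc n} a b = (toℕ a + toℕ b) mod (suc n)

IsAutℤ : (n : ℕ) → (Fin n → Fin n) → Set
IsAutℤ n f = (∀ x y → f (x +ₙ y) ≡ f x +ₙ f y) × Bijective _≡_ _≡_ f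

IsHomToAut : {P : Set} → Op₂ P → (n : ℕ) → (P → Fin n → Fin n) → Set
IsHomToAut {P} _∙_ n φ =
  (∀ b → IsAutℤ n (φ b)) × (∀ b b' x → φ (b ∙ b') x ≡ φ b (φ b' x))

SDP : ℕ → Set → Set
SDP n P = Fin n × P

sdpMul : ∀ {n} {P : Set} → Op₂ P → (P → Fin n → Fin n) → Op₂ (SDP n P)
sdpMul _∙_ φ (a , b) (a' , b') = (a +ₙ φ b a') , (b ∙ b')

-- Positive powers: pow _·_ g k = g^k for k ≥ 1 (g^1 = g, g^(k+1) = g^k · g).
-- The value at k = 0 is never used (adjacency requires k > 0).
pow : {G : Set} → Op₂ G → G → ℕ → G
pow _·_ g zero = g
pow _·_ g (suc zero) = g
pow _·_ g (suc (suc k)) = pow _·_ g (suc k) · g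

ExclPowAdj : {G : Set} → Op₂ G → (ℕ → Set) → G → G → Set
ExclPowAdj _·_ X g h =
  g ≢ h × ∃ λ k → k > 0 × (∀ x → X x → ¬ (x ∣ k)) ×
                   (h ≡ pow _·_ g k ⊎ g ≡ pow _·_ h k)

-- A graph (V, E) is a disjoint union of cliques: V is partitioned into blocks
-- (the fibres of a labelling c), each inducing a complete graph, with no edges
-- between different blocks.
IsDisjointUnionOfCliques : (V : Set) → (V → V → Set) → Set₁
IsDisjointUnionOfCliques V E =
  Σ Set λ I → Σ (V → I) λ c → ∀ u v → u ≢ v → (E u v ⇔ (c u ≡ c v))

{-# OPTIONS --safe #-}
module Submission where

-- Write N = q ^ s and π = p ^ (n + 1). Lagrange's theorem in P, proved by counting the orbits of
-- left multiplication by b, gives b ^ π = 1, so every g in G = ℤ_N ⋊ P satisfies g ^ (N π) = 1.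
-- Exponents α ≡ 1, β ≡ 0 (mod π) and α ≡ 0, β ≡ 1 (mod N) split g = g ^ β · g ^ α into a p-part
-- g ^ α and a p′-part g ^ β lying in the cyclic q-group ℤ_N × {1}. If h = g ^ k with p ∤ k, then
-- h ^ α = (g ^ α) ^ k. Conversely, if h ^ α = (g ^ α) ^ c with p ∤ c, then, as the subgroups of
-- ℤ_N form a chain, we may assume h ^ β = (g ^ β) ^ r, and h = g ^ (r β + c α) with p ∤ r β + c α.
-- So distinct g, h are adjacent iff their p-parts are p′-powers of each other, which is an
-- equivalence relation; its classes are the cliques.

open import Defs
open import Data.Nat using (ℕ; _^_)
open import Data.Nat.Primality using (Prime)
open import Data.Fin using (Fin)
open import Data.Product using (∃; _,_)
open import Relation.Binary.PropositionalEquality using (_≡_; _≢_)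
open import Function.Bundles using (_↔_)
open import Algebra.Core using (Op₁; Op₂)
open import Algebra.Structures using (IsGroup)

open import Level using (0ℓ)
open import Algebra.Bundles using (Monoid; Group)
open import Algebra.Structures using (IsMonoid)
open import Data.Nat
  using (zero; suc; pred; _+_; _*_; _∸_; _<_; _≤_; _<?_; s≤s; z≤n; NonZero; >-nonZero; >-nonZero⁻¹; ≢-nonZero⁻¹)
open import Data.Nat.Properties
  using ( +-assoc; +-comm; +-suc; +-identityʳ; *-assoc; *-comm; *-zeroʳ; m^n≢0; m*n≢0; anyUpTo?
        ; ≤-refl; <⇒≤; ≤-<-trans; m≤n⇒m≤1+n; m<1+n⇒m<n∨m≡n; n<1+n; m<n+m; m∸n≤m; m<n⇒0<n∸m
        ; m∸n+n≡m; m+[n∸m]≡n; suc-pred )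
open import Data.Nat.DivMod
  using ( _%_; _/_; _mod_; m≡m%n+[m/n]*n; m%n<n; m<n⇒m%n≡m; n%1≡0; [m+kn]%n≡m%n; %-congʳ
        ; %-distribˡ-+; m%n%n≡m%n; m*n%n≡0; m%n*o≡m*o%[n*o] )
open import Data.Nat.Divisibility
  using ( _∣_; _∤_; divides; _∣?_; _∣0; ∣-refl; ∣-trans; ∣1⇒≡1; ∣m∣n⇒∣m+n; ∣m+n∣m⇒∣n; ∣n⇒∣m*n
        ; ∣m⇒∣m*n; m∣m*n; ∣n∣m%n⇒∣m )
open import Data.Nat.Coprimality using (Coprime; coprime-Bézout; coprime-divisor)
import Data.Nat.Coprimality as Coprimality
open import Data.Nat.GCD using (module Bézout)
open import Data.Nat.Primality using (¬prime[1]; prime⇒irreducible; prime⇒nonZero; euclidsLemma)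
open import Data.Nat.GeneralisedArithmetic using (fold; fold-+)
open import Data.Nat.Induction using (<-rec)
open import Data.Nat.Tactic.RingSolver using (solve-∀)
open import Data.Fin using (zero; suc; toℕ)
open import Data.Fin.Properties using (toℕ-injective; toℕ-fromℕ<; toℕ<n; pigeonhole; inj⇒≟; *↔×)
open import Data.Fin.Subset using (Subset; _∈_; _∉_; _─_; _-_; ∣_∣; ⁅_⁆; ⊤; inside; outside)
open import Data.Fin.Subset.Properties
  using (p─⊥≡p; p─q⊆p; x∈p∧x≢y⇒x∈p-y; x∈⁅x⁆; nonempty?; Empty-unique; ∣⊥∣≡0; ∣⊤∣≡n; ∈⊤)
open import Data.Vec using (_∷_; here; there; tabulate; lookup)
open import Data.Vec.Properties using (tabulate-cong; lookup∘tabulate)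
open import Data.Bool using (true)
open import Data.Product using (∃₂; _×_; proj₁; proj₂)
open import Data.Product.Function.NonDependent.Propositional using (_×-↔_)
open import Data.Sum using (_⊎_; inj₁; inj₂; [_,_])
import Data.Sum as Sum
open import Function using (_∘_; _⇔_; mk⇔; Inverse; Injection)
open import Function.Construct.Composition using (_⇔-∘_; _↔-∘_)
open import Function.Properties.Inverse using (↔-refl; ↔-sym; ↔⇒↣)
open import Relation.Nullary using (¬_; Dec; yes; no; does; ¬?; contradiction)
open import Relation.Nullary.Decidable using (_×-dec_; does-⇔; dec-true)
import Relation.Nullary.Decidable as Dec
open import Relation.Unary using (Decidable)
open import Relation.Binary using (Rel; IsDecEquivalence; DecidableEquality)
open import Relation.Binary.PropositionalEquality
  using (refl; sym; trans; cong; cong₂; subst; isEquivalence; module ≡-Reasoning)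

coprime⇒invertible : ∀ {m n} .{{_ : NonZero m}} → Coprime m n → ∃₂ λ w j → w * m ≡ 1 + j * n
coprime⇒invertible {suc m₀} {n} c with coprime-Bézout c
... | Bézout.+- x y 1+yn≡xm = x , y , sym 1+yn≡xm
... | Bézout.-+ x y 1+xm≡yn = 1 + m₀ * x , m₀ * y , (begin
  (1 + m₀ * x) * suc m₀    ≡⟨ rearrange m₀ x ⟩
  1 + m₀ * (1 + x * suc m₀) ≡⟨ cong (λ t → 1 + m₀ * t) 1+xm≡yn ⟩
  1 + m₀ * (y * n)          ≡⟨ cong suc (*-assoc m₀ y n) ⟨
  1 + m₀ * y * n            ∎)
  where
  open ≡-Reasoning
  rearrange : ∀ m₀ x → (1 + m₀ * x) * suc m₀ ≡ 1 + m₀ * (1 + x * suc m₀)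
  rearrange = solve-∀

prime∤1 : ∀ {p} → Prime p → p ∤ 1
prime∤1 p-prime p∣1 = ¬prime[1] (subst Prime (∣1⇒≡1 p∣1) p-prime)

p∣n⇒p∤1+j*n : ∀ {p n} j → Prime p → p ∣ n → p ∤ 1 + j * n
p∣n⇒p∤1+j*n {p} {n} j p-prime p∣n p∣1+jn =
  prime∤1 p-prime (∣m+n∣m⇒∣n (subst (p ∣_) (+-comm 1 (j * n)) p∣1+jn) (∣n⇒∣m*n j p∣n))

prime∤⇒coprime : ∀ {p a} → Prime p → p ∤ a → Coprime a p
prime∤⇒coprime p-prime p∤a {d} (d∣a , d∣p) with prime⇒irreducible p-prime d∣p
... | inj₁ d≡1 = d≡1
... | inj₂ refl = contradiction d∣a p∤a

coprime-* : ∀ {a m n} → Coprime a m → Coprime a n → Coprime a (m * n)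
coprime-* {m = m} a⊥m a⊥n {d} (d∣a , d∣mn) = a⊥n (d∣a , coprime-divisor d⊥m d∣mn)
  where
  d⊥m : Coprime d m
  d⊥m (e∣d , e∣m) = a⊥m (∣-trans e∣d d∣a , e∣m)

coprime-^ : ∀ {a m} → Coprime a m → ∀ k → Coprime a (m ^ k)
coprime-^ a⊥m zero    (_ , d∣1) = ∣1⇒≡1 d∣1
coprime-^ a⊥m (suc k) = coprime-* a⊥m (coprime-^ a⊥m k)

distinct-primes⇒coprime : ∀ {p q} → Prime p → Prime q → p ≢ q → Coprime p q
distinct-primes⇒coprime {p} {q} p-prime q-prime p≢q = prime∤⇒coprime q-prime q∤p
  where
  q∤p : q ∤ p
  q∤p q∣p with prime⇒irreducible p-prime q∣p
  ... | inj₁ refl = ¬prime[1] q-prime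
  ... | inj₂ refl = p≢q refl

IsMultipleMod : (m : ℕ) .{{_ : NonZero m}} → ℕ → ℕ → Set
IsMultipleMod m u v = ∃ λ r → (r * u) % m ≡ v % m

module _ {m : ℕ} .{{_ : NonZero m}} where

  coprime⇒isMultipleMod : ∀ {u} .{{u≢0 : NonZero u}} → Coprime u m → ∀ v → IsMultipleMod m u v
  coprime⇒isMultipleMod {u} u⊥m v with coprime⇒invertible u⊥m
  ... | w , j , wu≡1+jm = v * w , (begin
    (v * w * u) % m         ≡⟨ cong (_% m) (*-assoc v w u) ⟩
    (v * (w * u)) % m       ≡⟨ cong (λ t → (v * t) % m) wu≡1+jm ⟩
    (v * (1 + j * m)) % m   ≡⟨ cong (_% m) (expand v j m) ⟩
    (v + v * j * m) % m     ≡⟨ [m+kn]%n≡m%n v (v * j) m ⟩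
    v % m                   ∎)
    where
    open ≡-Reasoning
    expand : ∀ v j m → v * (1 + j * m) ≡ v + v * j * m
    expand = solve-∀

  isMultipleMod-*ʳ : ∀ {u v} o .{{_ : NonZero (m * o)}} →
                     IsMultipleMod m u v → IsMultipleMod (m * o) (u * o) (v * o)
  isMultipleMod-*ʳ {u} {v} o (r , ru≡v) = r , (begin
    (r * (u * o)) % (m * o) ≡⟨ cong (_% (m * o)) (*-assoc r u o) ⟨
    (r * u * o) % (m * o)   ≡⟨ m%n*o≡m*o%[n*o] (r * u) m o ⟨
    (r * u) % m * o         ≡⟨ cong (_* o) ru≡v ⟩
    v % m * o               ≡⟨ m%n*o≡m*o%[n*o] v m o ⟩
    (v * o) % (m * o)       ∎)
    where open ≡-Reasoning

  isMultipleMod-congˡ : ∀ {m′ u v} .{{_ : NonZero m′}} → m ≡ m′ →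
                        IsMultipleMod m u v → IsMultipleMod m′ u v
  isMultipleMod-congˡ m≡m′ (r , ru≡v) =
    r , trans (%-congʳ (sym m≡m′)) (trans ru≡v (%-congʳ m≡m′))

∤⇒nonZero : ∀ {d n} → d ∤ n → NonZero n
∤⇒nonZero {d} {zero}  d∤0 = contradiction (d ∣0) d∤0
∤⇒nonZero {d} {suc n} _   = _

module _ {q : ℕ} (q-prime : Prime q) where

  private instance
    q≢0 : NonZero q
    q≢0 = prime⇒nonZero q-prime

  ∤⇒isMultipleMod : ∀ {s u} → q ∤ u → ∀ v → IsMultipleMod (q ^ s) {{m^n≢0 q s}} u v
  ∤⇒isMultipleMod {s} q∤u = coprime⇒isMultipleMod {{m^n≢0 q s}} {{∤⇒nonZero q∤u}}
    (coprime-^ (prime∤⇒coprime q-prime q∤u) s)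

  isMultipleMod-total : ∀ s {m} .{{_ : NonZero m}} → m ≡ q ^ s → ∀ u v →
                        IsMultipleMod m u v ⊎ IsMultipleMod m v u
  isMultipleMod-total zero refl u v = inj₁ (0 , trans (n%1≡0 0) (sym (n%1≡0 v)))
  isMultipleMod-total (suc s) refl u v with q ∣? u | q ∣? v
  ... | no q∤u | _      = inj₁ (∤⇒isMultipleMod {suc s} q∤u v)
  ... | yes _  | no q∤v = inj₂ (∤⇒isMultipleMod {suc s} q∤v u)
  ... | yes (divides u′ refl) | yes (divides v′ refl) =
    Sum.map scale scale (isMultipleMod-total s refl u′ v′)
    where
    instance _ = m^n≢0 q s
    instance _ = m*n≢0 (q ^ s) q
    scale : ∀ {a b} → IsMultipleMod (q ^ s) a b → IsMultipleMod (q ^ suc s) (a * q) (b * q)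
    scale = isMultipleMod-congˡ (*-comm (q ^ s) q) ∘ isMultipleMod-*ʳ {m = q ^ s} q

-- n ×′ g is the power gⁿ: the library's multiplication by ℕ in a monoid, read multiplicatively.
module Powers {G : Set} {_·_ : Op₂ G} {e : G} (isMonoid : IsMonoid _≡_ _·_ e) where

  monoid : Monoid 0ℓ 0ℓ
  monoid = record { Carrier = G ; _≈_ = _≡_ ; _∙_ = _·_ ; ε = e ; isMonoid = isMonoid }

  open Monoid monoid public using (_∙_; ε)
  open Monoid monoid using (identityʳ)
  open import Algebra.Properties.Monoid.Mult.TCOptimised monoid public
    using (×-homo-+; ×-assocˡ; 1+×) renaming (_×_ to _×′_)

  ×-ε : ∀ n → n ×′ ε ≡ ε
  ×-ε n = trans (×-assocˡ ε n 0) (cong (_×′ ε) (*-zeroʳ n))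

  ×-swap : ∀ m n x → m ×′ (n ×′ x) ≡ n ×′ (m ×′ x)
  ×-swap m n x =
    trans (×-assocˡ x m n) (trans (cong (_×′ x) (*-comm m n)) (sym (×-assocˡ x n m)))

  pow≡× : ∀ g k → pow _·_ g (suc k) ≡ suc k ×′ g
  pow≡× g zero    = refl
  pow≡× g (suc k) = cong (_∙ g) (pow≡× g k)

  ×-1+k*m : ∀ {m x} k → m ×′ x ≡ ε → (1 + k * m) ×′ x ≡ x
  ×-1+k*m {m} {x} k mx≡ε = begin
    (1 + k * m) ×′ x          ≡⟨ ×-homo-+ x 1 (k * m) ⟩
    x ∙ (k * m) ×′ x          ≡⟨ cong (x ∙_) (×-assocˡ x k m) ⟨
    x ∙ k ×′ (m ×′ x)         ≡⟨ cong (λ y → x ∙ k ×′ y) mx≡ε ⟩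
    x ∙ k ×′ ε                ≡⟨ cong (x ∙_) (×-ε k) ⟩
    x ∙ ε                     ≡⟨ identityʳ x ⟩
    x                         ∎
    where open ≡-Reasoning

  ×-mod : ∀ {m} .{{_ : NonZero m}} {x} → m ×′ x ≡ ε → ∀ c → c ×′ x ≡ (c % m) ×′ x
  ×-mod {m} {x} mx≡ε c = begin
    c ×′ x                                 ≡⟨ cong (_×′ x) (m≡m%n+[m/n]*n c m) ⟩
    (c % m + c / m * m) ×′ x               ≡⟨ ×-homo-+ x (c % m) (c / m * m) ⟩
    (c % m) ×′ x ∙ ((c / m) * m) ×′ x       ≡⟨ cong ((c % m) ×′ x ∙_) (×-assocˡ x (c / m) m) ⟨
    (c % m) ×′ x ∙ (c / m) ×′ (m ×′ x)       ≡⟨ cong (λ y → (c % m) ×′ x ∙ (c / m) ×′ y) mx≡ε ⟩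
    (c % m) ×′ x ∙ (c / m) ×′ ε             ≡⟨ cong ((c % m) ×′ x ∙_) (×-ε (c / m)) ⟩
    (c % m) ×′ x ∙ ε                       ≡⟨ identityʳ _ ⟩
    (c % m) ×′ x                           ∎
    where open ≡-Reasoning

  infix 4 _∈⟨_⟩
  _∈⟨_⟩ : G → G → Set
  h ∈⟨ g ⟩ = ∃ λ r → h ≡ r ×′ g

  ExclPower : ℕ → G → G → Set
  ExclPower p g h = ∃ λ k → p ∤ k × h ≡ k ×′ g

  exclPowAdj⇔exclPower : ∀ {p g h} → g ≢ h →
    ExclPowAdj _·_ (_≡ p) g h ⇔ (ExclPower p g h ⊎ ExclPower p h g)
  exclPowAdj⇔exclPower {p} {g} {h} g≢h = mk⇔ to from
    where
    to : ExclPowAdj _·_ (_≡ p) g h → ExclPower p g h ⊎ ExclPower p h g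
    to (_ , suc k , _ , p∤ , inj₁ h≡gᵏ) = inj₁ (suc k , p∤ p refl , trans h≡gᵏ (pow≡× g k))
    to (_ , suc k , _ , p∤ , inj₂ g≡hᵏ) = inj₂ (suc k , p∤ p refl , trans g≡hᵏ (pow≡× h k))
    from : ExclPower p g h ⊎ ExclPower p h g → ExclPowAdj _·_ (_≡ p) g h
    from (inj₁ (zero  , p∤0 , _)) = contradiction (p ∣0) p∤0
    from (inj₂ (zero  , p∤0 , _)) = contradiction (p ∣0) p∤0
    from (inj₁ (suc k , p∤k , h≡kg)) =
      g≢h , suc k , s≤s z≤n , (λ { _ refl → p∤k }) , inj₁ (trans h≡kg (sym (pow≡× g k)))
    from (inj₂ (suc k , p∤k , g≡kh)) =
      g≢h , suc k , s≤s z≤n , (λ { _ refl → p∤k }) , inj₂ (trans g≡kh (sym (pow≡× h k)))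

  module _ {p} (p-prime : Prime p) where

    exclPower-refl : ∀ g → ExclPower p g g
    exclPower-refl g = 1 , prime∤1 p-prime , refl

    exclPower-trans : ∀ {g h l} → ExclPower p g h → ExclPower p h l → ExclPower p g l
    exclPower-trans {g} (k , p∤k , h≡kg) (k′ , p∤k′ , l≡k′h) =
      k′ * k , [ p∤k′ , p∤k ] ∘ euclidsLemma k′ k p-prime ,
      trans l≡k′h (trans (cong (k′ ×′_) h≡kg) (×-assocˡ g k′ k))

    exclPower-× : ∀ n {g h} → ExclPower p g h → ExclPower p (n ×′ g) (n ×′ h)
    exclPower-× n {g} (k , p∤k , h≡kg) = k , p∤k , trans (cong (n ×′_) h≡kg) (×-swap n k g)

    exclPower-sym : ∀ k {g h} → (p ^ suc k) ×′ g ≡ ε → ExclPower p g h → ExclPower p h g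
    exclPower-sym k {g} {h} pᵏg≡ε (c , p∤c , h≡cg)
      with coprime⇒invertible {{∤⇒nonZero p∤c}} (coprime-^ (prime∤⇒coprime p-prime p∤c) (suc k))
    ... | w , j , wc≡1+jpᵏ = w , p∤w , sym (begin
      w ×′ h                          ≡⟨ cong (w ×′_) h≡cg ⟩
      w ×′ (c ×′ g)                    ≡⟨ ×-assocˡ g w c ⟩
      (w * c) ×′ g                    ≡⟨ cong (_×′ g) wc≡1+jpᵏ ⟩
      (1 + j * p ^ suc k) ×′ g        ≡⟨ ×-1+k*m j pᵏg≡ε ⟩
      g                              ∎)
      where
      open ≡-Reasoning
      p∤w : p ∤ w
      p∤w p∣w = p∣n⇒p∤1+j*n j p-prime (∣m⇒∣m*n (p ^ k) (∣-refl {p}))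
                  (subst (p ∣_) wc≡1+jpᵏ (∣m⇒∣m*n c p∣w))

x∈p─q⇒x∉q : ∀ {n} {x : Fin n} (p q : Subset n) → x ∈ p ─ q → x ∉ q
x∈p─q⇒x∉q (_ ∷ p) (outside ∷ q) here        ()
x∈p─q⇒x∉q (_ ∷ p) (_       ∷ q) (there x∈) (there x∈q) = x∈p─q⇒x∉q p q x∈ x∈q

x∈p⇒∣p∣≡1+∣p-x∣ : ∀ {n} {x : Fin n} {p : Subset n} → x ∈ p → ∣ p ∣ ≡ suc ∣ p - x ∣
x∈p⇒∣p∣≡1+∣p-x∣ {p = inside ∷ p}  here         = cong (suc ∘ ∣_∣) (sym (p─⊥≡p p))
x∈p⇒∣p∣≡1+∣p-x∣ {p = inside ∷ p}  (there x∈p) = cong suc (x∈p⇒∣p∣≡1+∣p-x∣ x∈p)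
x∈p⇒∣p∣≡1+∣p-x∣ {p = outside ∷ p} (there x∈p) = x∈p⇒∣p∣≡1+∣p-x∣ x∈p

x∈p-y⇒x≢y : ∀ {n} {x y : Fin n} {p : Subset n} → x ∈ p - y → x ≢ y
x∈p-y⇒x≢y {y = y} {p} x∈p-y refl = x∈p─q⇒x∉q p ⁅ y ⁆ x∈p-y (x∈⁅x⁆ y)

module OrbitCounting {m : ℕ} (F : Fin m → Fin m) (d : ℕ) .{{_ : NonZero d}}
  (period : ∀ x → fold x F d ≡ x)
  (free : ∀ x {k} → 0 < k → k < d → fold x F k ≢ x) where

  Closed : Subset m → Set
  Closed S = ∀ {y} → y ∈ S → F y ∈ S

  closed-fold : ∀ {S y} → Closed S → y ∈ S → ∀ k → fold y F k ∈ S
  closed-fold S-closed y∈S zero    = y∈S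
  closed-fold S-closed y∈S (suc k) = S-closed (closed-fold S-closed y∈S k)

  fold-pred : ∀ y → fold y F d ≡ fold (F y) F (pred d)
  fold-pred y = trans (cong (fold y F) (trans (sym (suc-pred d)) (+-comm 1 (pred d))))
                      (fold-+ y F (pred d))

  F-injective : ∀ {y z} → F y ≡ F z → y ≡ z
  F-injective {y} {z} Fy≡Fz = begin
    y                         ≡⟨ period y ⟨
    fold y F d                ≡⟨ fold-pred y ⟩
    fold (F y) F (pred d)     ≡⟨ cong (λ w → fold w F (pred d)) Fy≡Fz ⟩
    fold (F z) F (pred d)     ≡⟨ fold-pred z ⟨
    fold z F d                ≡⟨ period z ⟩
    z                         ∎
    where open ≡-Reasoning

  orbit-distinct : ∀ x {i j} → i < j → j < d → fold x F j ≢ fold x F i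
  orbit-distinct x {i} {j} i<j j<d xⱼ≡xᵢ =
    free (fold x F i) (m<n⇒0<n∸m i<j) (≤-<-trans (m∸n≤m j i) j<d) (begin
      fold (fold x F i) F (j ∸ i) ≡⟨ fold-+ x F (j ∸ i) ⟨
      fold x F (j ∸ i + i)        ≡⟨ cong (fold x F) (m∸n+n≡m (<⇒≤ i<j)) ⟩
      fold x F j                  ≡⟨ xⱼ≡xᵢ ⟩
      fold x F i                  ∎)
    where open ≡-Reasoning

  strip : Subset m → Fin m → ℕ → Subset m
  strip S x zero    = S
  strip S x (suc j) = strip S x j - fold x F j

  ∈-strip⁺ : ∀ {S x y} j → y ∈ S → (∀ {k} → k < j → y ≢ fold x F k) → y ∈ strip S x j
  ∈-strip⁺ zero    y∈S _  = y∈S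
  ∈-strip⁺ (suc j) y∈S y∉ = x∈p∧x≢y⇒x∈p-y (∈-strip⁺ j y∈S (y∉ ∘ m≤n⇒m≤1+n)) (y∉ ≤-refl)

  ∈-strip⁻ : ∀ {S x y} j → y ∈ strip S x j → y ∈ S × (∀ {k} → k < j → y ≢ fold x F k)
  ∈-strip⁻ zero    y∈ = y∈ , λ ()
  ∈-strip⁻ {S} {x} (suc j) y∈ with ∈-strip⁻ j (p─q⊆p (strip S x j) ⁅ fold x F j ⁆ y∈)
  ... | y∈S , y∉ = y∈S , y∉′
    where
    y∉′ : ∀ {k} → k < suc j → _ ≢ fold x F k
    y∉′ k<1+j with m<1+n⇒m<n∨m≡n k<1+j
    ... | inj₁ k<j  = y∉ k<j
    ... | inj₂ refl = x∈p-y⇒x≢y y∈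

  ∣strip∣ : ∀ {S x} → Closed S → x ∈ S → ∀ j → j ≤ d → ∣ S ∣ ≡ j + ∣ strip S x j ∣
  ∣strip∣         S-closed x∈S zero    _     = refl
  ∣strip∣ {S} {x} S-closed x∈S (suc j) 1+j≤d = begin
    ∣ S ∣                          ≡⟨ ∣strip∣ S-closed x∈S j (<⇒≤ 1+j≤d) ⟩
    j + ∣ strip S x j ∣            ≡⟨ cong (j +_) (x∈p⇒∣p∣≡1+∣p-x∣ xⱼ∈) ⟩
    j + suc ∣ strip S x (suc j) ∣  ≡⟨ +-suc j _ ⟩
    suc j + ∣ strip S x (suc j) ∣  ∎
    where
    open ≡-Reasoning
    xⱼ∈ : fold x F j ∈ strip S x j
    xⱼ∈ = ∈-strip⁺ j (closed-fold S-closed x∈S j) (λ k<j → orbit-distinct x k<j 1+j≤d)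

  strip-closed : ∀ {S x} → Closed S → Closed (strip S x d)
  strip-closed {S} {x} S-closed {y} y∈ with ∈-strip⁻ d y∈
  ... | y∈S , y∉orbit = ∈-strip⁺ d (S-closed y∈S) Fy∉orbit
    where
    Fy∉orbit : ∀ {k} → k < d → F y ≢ fold x F k
    Fy∉orbit {zero}  _     Fy≡x    = y∉orbit (subst (pred d <_) (suc-pred d) (n<1+n (pred d)))
                                             (F-injective (trans Fy≡x (sym F[last]≡x)))
      where
      F[last]≡x : F (fold x F (pred d)) ≡ x
      F[last]≡x = trans (cong (fold x F) (suc-pred d)) (period x)
    Fy∉orbit {suc k} 1+k<d Fy≡xₖ₊₁ = y∉orbit (<⇒≤ 1+k<d) (F-injective Fy≡xₖ₊₁)

  d∣∣closed∣ : ∀ S → Closed S → d ∣ ∣ S ∣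
  d∣∣closed∣ S = <-rec Motive step ∣ S ∣ S refl
    where
    Motive : ℕ → Set
    Motive n = ∀ S → ∣ S ∣ ≡ n → Closed S → d ∣ ∣ S ∣
    step : ∀ n → (∀ {n′} → n′ < n → Motive n′) → Motive n
    step _ rec S refl S-closed with nonempty? S
    ... | no  S-empty = subst (d ∣_) (sym (trans (cong ∣_∣ (Empty-unique S-empty)) (∣⊥∣≡0 m))) (d ∣0)
    ... | yes (x , x∈S) =
      subst (d ∣_) (sym ∣S∣≡d+∣S′∣) (∣m∣n⇒∣m+n ∣-refl (rec ∣S′∣<∣S∣ _ refl (strip-closed S-closed)))
      where
      ∣S∣≡d+∣S′∣ = ∣strip∣ S-closed x∈S d ≤-refl
      ∣S′∣<∣S∣ : ∣ strip S x d ∣ < ∣ S ∣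
      ∣S′∣<∣S∣ = subst (∣ strip S x d ∣ <_) (sym ∣S∣≡d+∣S′∣) (m<n+m _ (>-nonZero⁻¹ d))

  d∣m : d ∣ m
  d∣m = subst (d ∣_) (∣⊤∣≡n m) (d∣∣closed∣ ⊤ (λ _ → ∈⊤))

least-witness : ∀ {Q : ℕ → Set} → Decidable Q → ∀ {n} → Q n →
                ∃ λ k → Q k × (∀ {j} → j < k → ¬ Q j)
least-witness {Q} Q? {n} = <-rec Motive step n
  where
  Motive : ℕ → Set
  Motive n = Q n → ∃ λ k → Q k × (∀ {j} → j < k → ¬ Q j)
  step : ∀ n → (∀ {k} → k < n → Motive k) → Motive n
  step n rec Qn with anyUpTo? Q? n
  ... | yes (k , k<n , Qk) = rec k<n Qk
  ... | no  ¬∃j<n          = n , Qn , λ j<n Qj → ¬∃j<n (_ , j<n , Qj)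

module _ {P : Set} {_·_ : Op₂ P} {e : P} {_⁻¹ : Op₁ P} (isGroup : IsGroup _≡_ _·_ e _⁻¹)
         {m : ℕ} (enum : P ↔ Fin m) where

  open Powers (IsGroup.isMonoid isGroup)
  open IsGroup isGroup using (assoc; identityˡ; identityʳ)
  private
    group : Group 0ℓ 0ℓ
    group = record { isGroup = isGroup }

  open import Algebra.Properties.Group group using (∙-cancelˡ; ∙-cancelʳ)
  open Inverse enum using (to; from; strictlyInverseˡ; strictlyInverseʳ)

  private
    to-injective : ∀ {x y} → to x ≡ to y → x ≡ y
    to-injective = Injection.injective (↔⇒↣ enum)

    _≟_ = inj⇒≟ (↔⇒↣ enum)

  ∃-period : ∀ b → ∃ λ t → 0 < t × t ×′ b ≡ ε
  ∃-period b with pigeonhole (n<1+n m) (λ i → to (toℕ i ×′ b))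
  ... | i , j , i<j , bⁱ≡bʲ = toℕ j ∸ toℕ i , m<n⇒0<n∸m i<j , ∙-cancelˡ (toℕ i ×′ b) _ _ (begin
    toℕ i ×′ b ∙ (toℕ j ∸ toℕ i) ×′ b   ≡⟨ ×-homo-+ b (toℕ i) (toℕ j ∸ toℕ i) ⟨
    (toℕ i + (toℕ j ∸ toℕ i)) ×′ b      ≡⟨ cong (_×′ b) (m+[n∸m]≡n (<⇒≤ i<j)) ⟩
    toℕ j ×′ b                          ≡⟨ to-injective bⁱ≡bʲ ⟨
    toℕ i ×′ b                          ≡⟨ identityʳ _ ⟨
    toℕ i ×′ b ∙ ε                      ∎)
    where open ≡-Reasoning

  card-annihilates : ∀ b → m ×′ b ≡ ε
  card-annihilates b with least-witness (λ t → 0 <? t ×-dec (t ×′ b) ≟ ε) (proj₂ (∃-period b))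
  ... | d , (0<d , bᵈ≡ε) , minimal = annihilate d∣m
    where
    F : Fin m → Fin m
    F i = to (b ∙ from i)

    fold-F : ∀ i k → fold i F k ≡ to (k ×′ b ∙ from i)
    fold-F i zero    = trans (sym (strictlyInverseˡ i)) (cong to (sym (identityˡ (from i))))
    fold-F i (suc k) = begin
      F (fold i F k)                        ≡⟨ cong F (fold-F i k) ⟩
      to (b ∙ from (to (k ×′ b ∙ from i)))  ≡⟨ cong (λ x → to (b ∙ x)) (strictlyInverseʳ _) ⟩
      to (b ∙ (k ×′ b ∙ from i))            ≡⟨ cong to (assoc b (k ×′ b) (from i)) ⟨
      to (b ∙ k ×′ b ∙ from i)              ≡⟨ cong (λ x → to (x ∙ from i)) (1+× k b) ⟨
      to (suc k ×′ b ∙ from i)              ∎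
      where open ≡-Reasoning

    period : ∀ i → fold i F d ≡ i
    period i = trans (fold-F i d) (trans (cong (λ x → to (x ∙ from i)) bᵈ≡ε)
                 (trans (cong to (identityˡ (from i))) (strictlyInverseˡ i)))

    free : ∀ i {k} → 0 < k → k < d → fold i F k ≢ i
    free i {k} 0<k k<d Fᵏi≡i = minimal k<d (0<k , ∙-cancelʳ (from i) _ _ (begin
      k ×′ b ∙ from i    ≡⟨ to-injective (trans (sym (fold-F i k)) Fᵏi≡to∘from[i]) ⟩
      from i             ≡⟨ identityˡ (from i) ⟨
      ε ∙ from i         ∎))
      where
      open ≡-Reasoning
      Fᵏi≡to∘from[i] : fold i F k ≡ to (from i)
      Fᵏi≡to∘from[i] = trans Fᵏi≡i (sym (strictlyInverseˡ i))

    open OrbitCounting F d {{>-nonZero 0<d}} period free using (d∣m)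

    annihilate : d ∣ m → m ×′ b ≡ ε
    annihilate (divides t refl) = trans (sym (×-assocˡ b t d)) (trans (cong (t ×′_) bᵈ≡ε) (×-ε t))

module _ {V : Set} {m} (enum : V ↔ Fin m)
         {_~_ : Rel V 0ℓ} (~-isDecEquivalence : IsDecEquivalence _~_) where

  open IsDecEquivalence ~-isDecEquivalence using ()
    renaming (_≟_ to _~?_; refl to ~-refl; sym to ~-sym; trans to ~-trans)
  open Inverse enum using (to; from; strictlyInverseʳ)

  classOf : V → Subset m
  classOf u = tabulate (λ i → does (u ~? from i))

  ~⇔classOf-≡ : ∀ u v → u ~ v ⇔ classOf u ≡ classOf v
  ~⇔classOf-≡ u v = mk⇔ ~⇒classOf-≡ classOf-≡⇒~
    where
    ~⇒classOf-≡ : u ~ v → classOf u ≡ classOf v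
    ~⇒classOf-≡ u~v = tabulate-cong λ i →
      does-⇔ (mk⇔ (~-trans (~-sym u~v)) (~-trans u~v)) (u ~? from i) (v ~? from i)

    classOf-≡⇒~ : classOf u ≡ classOf v → u ~ v
    classOf-≡⇒~ classes≡ = subst (u ~_) (strictlyInverseʳ v) (witness (u ~? from (to v))
      (trans decisions≡ (dec-true (v ~? from (to v)) v~from[to[v]])))
      where
      witness : ∀ {A : Set} (a? : Dec A) → does a? ≡ true → A
      witness (yes a) _ = a
      v~from[to[v]] : v ~ from (to v)
      v~from[to[v]] = subst (v ~_) (sym (strictlyInverseʳ v)) ~-refl
      decisions≡ : does (u ~? from (to v)) ≡ does (v ~? from (to v))
      decisions≡ = trans (sym (lookup∘tabulate _ (to v)))
                         (trans (cong (λ c → lookup c (to v)) classes≡) (lookup∘tabulate _ (to v)))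

  decEquivalence⇒disjointUnionOfCliques : {E : Rel V 0ℓ} → (∀ u v → u ≢ v → E u v ⇔ u ~ v) →
                                          IsDisjointUnionOfCliques V E
  decEquivalence⇒disjointUnionOfCliques E⇔~ =
    Subset m , classOf , λ u v u≢v → ~⇔classOf-≡ u v ⇔-∘ E⇔~ u v u≢v

module PrimaryParts {G : Set} {_·_ : Op₂ G} {e : G} (isMonoid : IsMonoid _≡_ _·_ e) where

  open Powers isMonoid

  -- The torsion exponent is p ^ suc k, not p ^ k, so that p divides it even when k = 0.
  record PrimaryDecomposition (p k : ℕ) : Set where
    field
      pExp p′Exp    : ℕ
      split         : ∀ g → p′Exp ×′ g ∙ pExp ×′ g ≡ g
      pPart-torsion : ∀ g → (p ^ suc k) ×′ (pExp ×′ g) ≡ ε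
      p∣p′Exp       : p ∣ p′Exp
      p∤pExp        : p ∤ pExp
      p′Parts-chain : ∀ g h → p′Exp ×′ h ∈⟨ p′Exp ×′ g ⟩ ⊎ p′Exp ×′ g ∈⟨ p′Exp ×′ h ⟩

  module _ (_≟_ : DecidableEquality G) {p k} (p-prime : Prime p) (D : PrimaryDecomposition p k) where

    open PrimaryDecomposition D

    pPart : G → G
    pPart g = pExp ×′ g

    _∼_ : Rel G 0ℓ
    g ∼ h = ExclPower p (pPart g) (pPart h)

    ∼-sym : ∀ {g h} → g ∼ h → h ∼ g
    ∼-sym {g} = exclPower-sym p-prime k (pPart-torsion g)

    ∼-dec : ∀ g h → Dec (g ∼ h)
    ∼-dec g h = Dec.map (mk⇔ unbounded bounded)
      (anyUpTo? (λ c → ¬? (p ∣? c) ×-dec (pPart h ≟ (c ×′ pPart g))) (p ^ suc k))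
      where
      instance
        pᵏ≢0 : NonZero (p ^ suc k)
        pᵏ≢0 = m^n≢0 p (suc k) {{prime⇒nonZero p-prime}}
      unbounded : (∃ λ c → c < p ^ suc k × (p ∤ c × pPart h ≡ c ×′ pPart g)) → g ∼ h
      unbounded (c , _ , g∼h) = c , g∼h
      bounded : g ∼ h → ∃ λ c → c < p ^ suc k × (p ∤ c × pPart h ≡ c ×′ pPart g)
      bounded (c , p∤c , hₚ≡gₚᶜ) = c % p ^ suc k , m%n<n c (p ^ suc k) ,
        p∤c ∘ ∣n∣m%n⇒∣m (m∣m*n (p ^ k)) , trans hₚ≡gₚᶜ (×-mod (pPart-torsion g) c)

    ∼-isDecEquivalence : IsDecEquivalence _∼_
    ∼-isDecEquivalence = record
      { isEquivalence = record
        { refl  = exclPower-refl p-prime _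
        ; sym   = ∼-sym
        ; trans = exclPower-trans p-prime
        }
      ; _≟_ = ∼-dec
      }

    exclPower⇒∼ : ∀ {g h} → ExclPower p g h → g ∼ h
    exclPower⇒∼ = exclPower-× p-prime pExp

    ∼∧p′Part∈⇒exclPower : ∀ {g h} → g ∼ h → p′Exp ×′ h ∈⟨ p′Exp ×′ g ⟩ → ExclPower p g h
    ∼∧p′Part∈⇒exclPower {g} {h} (c , p∤c , hₚ≡gₚᶜ) (r , hₚ′≡gₚ′ʳ) =
      r * p′Exp + c * pExp , p∤exponent , sym (begin
        (r * p′Exp + c * pExp) ×′ g              ≡⟨ ×-homo-+ g (r * p′Exp) (c * pExp) ⟩
        (r * p′Exp) ×′ g ∙ (c * pExp) ×′ g       ≡⟨ cong₂ _∙_ (×-assocˡ g r p′Exp) (×-assocˡ g c pExp) ⟨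
        r ×′ (p′Exp ×′ g) ∙ c ×′ (pExp ×′ g)     ≡⟨ cong₂ _∙_ hₚ′≡gₚ′ʳ hₚ≡gₚᶜ ⟨
        p′Exp ×′ h ∙ pExp ×′ h                   ≡⟨ split h ⟩
        h                                        ∎)
      where
      open ≡-Reasoning
      p∤exponent : p ∤ r * p′Exp + c * pExp
      p∤exponent p∣ =
        [ p∤c , p∤pExp ] (euclidsLemma c pExp p-prime (∣m+n∣m⇒∣n p∣ (∣n⇒∣m*n r p∣p′Exp)))

    exclPower⇔∼ : ∀ g h → (ExclPower p g h ⊎ ExclPower p h g) ⇔ g ∼ h
    exclPower⇔∼ g h = mk⇔ [ exclPower⇒∼ , ∼-sym ∘ exclPower⇒∼ ] ∼⇒exclPower
      where
      ∼⇒exclPower : g ∼ h → ExclPower p g h ⊎ ExclPower p h g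
      ∼⇒exclPower g∼h with p′Parts-chain g h
      ... | inj₁ h′∈⟨g′⟩ = inj₁ (∼∧p′Part∈⇒exclPower g∼h h′∈⟨g′⟩)
      ... | inj₂ g′∈⟨h′⟩ = inj₂ (∼∧p′Part∈⇒exclPower (∼-sym g∼h) g′∈⟨h′⟩)

module ModularAddition (N₀ : ℕ) where

  private N = suc N₀

  toℕ-mod : ∀ x → toℕ (x mod N) ≡ x % N
  toℕ-mod x = toℕ-fromℕ< (m%n<n x N)

  toℕ-+ₙ : ∀ (a b : Fin N) → toℕ (a +ₙ b) ≡ (toℕ a + toℕ b) % N
  toℕ-+ₙ a b = toℕ-mod (toℕ a + toℕ b)

  toℕ%N : ∀ (a : Fin N) → toℕ a % N ≡ toℕ a
  toℕ%N a = m<n⇒m%n≡m (toℕ<n a)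

  %-absorbˡ : ∀ x y → (x % N + y) % N ≡ (x + y) % N
  %-absorbˡ x y = begin
    (x % N + y) % N             ≡⟨ %-distribˡ-+ (x % N) y N ⟩
    (x % N % N + y % N) % N     ≡⟨ cong (λ t → (t + y % N) % N) (m%n%n≡m%n x N) ⟩
    (x % N + y % N) % N         ≡⟨ %-distribˡ-+ x y N ⟨
    (x + y) % N                 ∎
    where open ≡-Reasoning

  %-absorbʳ : ∀ x y → (x + y % N) % N ≡ (x + y) % N
  %-absorbʳ x y = begin
    (x + y % N) % N             ≡⟨ cong (_% N) (+-comm x (y % N)) ⟩
    (y % N + x) % N             ≡⟨ %-absorbˡ y x ⟩
    (y + x) % N                 ≡⟨ cong (_% N) (+-comm y x) ⟩
    (x + y) % N                 ∎
    where open ≡-Reasoning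

  +ₙ-assoc : ∀ (a b c : Fin N) → (a +ₙ b) +ₙ c ≡ a +ₙ (b +ₙ c)
  +ₙ-assoc a b c = toℕ-injective (begin
    toℕ ((a +ₙ b) +ₙ c)                   ≡⟨ toℕ-+ₙ (a +ₙ b) c ⟩
    (toℕ (a +ₙ b) + toℕ c) % N            ≡⟨ cong (λ t → (t + toℕ c) % N) (toℕ-+ₙ a b) ⟩
    ((toℕ a + toℕ b) % N + toℕ c) % N     ≡⟨ %-absorbˡ (toℕ a + toℕ b) (toℕ c) ⟩
    (toℕ a + toℕ b + toℕ c) % N           ≡⟨ cong (_% N) (+-assoc (toℕ a) (toℕ b) (toℕ c)) ⟩
    (toℕ a + (toℕ b + toℕ c)) % N         ≡⟨ %-absorbʳ (toℕ a) (toℕ b + toℕ c) ⟨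
    (toℕ a + (toℕ b + toℕ c) % N) % N     ≡⟨ cong (λ t → (toℕ a + t) % N) (toℕ-+ₙ b c) ⟨
    (toℕ a + toℕ (b +ₙ c)) % N            ≡⟨ toℕ-+ₙ a (b +ₙ c) ⟨
    toℕ (a +ₙ (b +ₙ c))                   ∎)
    where open ≡-Reasoning

  +ₙ-identityˡ : ∀ (a : Fin N) → zero +ₙ a ≡ a
  +ₙ-identityˡ a = toℕ-injective (trans (toℕ-+ₙ zero a) (toℕ%N a))

  +ₙ-identityʳ : ∀ (a : Fin N) → a +ₙ zero ≡ a
  +ₙ-identityʳ a = toℕ-injective (trans (toℕ-+ₙ a zero) (trans (cong (_% N) (+-identityʳ (toℕ a))) (toℕ%N a)))

  [N*x]modN≡0 : ∀ x → (N * x) mod N ≡ zero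
  [N*x]modN≡0 x = toℕ-injective (trans (toℕ-mod (N * x)) (trans (cong (_% N) (*-comm N x)) (m*n%n≡0 x N)))

  +ₙ-mod : ∀ (a : Fin N) r → a +ₙ ((r * toℕ a) mod N) ≡ (suc r * toℕ a) mod N
  +ₙ-mod a r = toℕ-injective (begin
    toℕ (a +ₙ ((r * toℕ a) mod N))        ≡⟨ toℕ-+ₙ a _ ⟩
    (toℕ a + toℕ ((r * toℕ a) mod N)) % N ≡⟨ cong (λ t → (toℕ a + t) % N) (toℕ-mod (r * toℕ a)) ⟩
    (toℕ a + (r * toℕ a) % N) % N         ≡⟨ %-absorbʳ (toℕ a) (r * toℕ a) ⟩
    (suc r * toℕ a) % N                   ≡⟨ toℕ-mod (suc r * toℕ a) ⟨
    toℕ ((suc r * toℕ a) mod N)           ∎)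
    where open ≡-Reasoning

module SemidirectProduct {P : Set} {_∙ᴾ_ : Op₂ P} {εᴾ : P} {_⁻¹ : Op₁ P}
  (P-isGroup : IsGroup _≡_ _∙ᴾ_ εᴾ _⁻¹)
  (N₀ : ℕ) (φ : P → Fin (suc N₀) → Fin (suc N₀)) (φ-isHom : IsHomToAut _∙ᴾ_ (suc N₀) φ) where

  open ModularAddition N₀
  open IsGroup P-isGroup using ()
    renaming (assoc to ∙ᴾ-assoc; identityˡ to ∙ᴾ-identityˡ; identityʳ to ∙ᴾ-identityʳ)
  open Powers (IsGroup.isMonoid P-isGroup) using ()
    renaming (_×′_ to _×ᴾ_; ×-ε to ×ᴾ-ε; ×-assocˡ to ×ᴾ-assocˡ; 1+× to 1+×ᴾ)

  N : ℕ
  N = suc N₀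

  G : Set
  G = SDP N P

  _·_ : Op₂ G
  _·_ = sdpMul _∙ᴾ_ φ

  ι : Fin N → G
  ι a = a , εᴾ

  φ-+ₙ : ∀ b x y → φ b (x +ₙ y) ≡ φ b x +ₙ φ b y
  φ-+ₙ b = proj₁ (proj₁ φ-isHom b)

  φ-∙ᴾ : ∀ b b′ x → φ (b ∙ᴾ b′) x ≡ φ b (φ b′ x)
  φ-∙ᴾ = proj₂ φ-isHom

  φ-εᴾ : ∀ x → φ εᴾ x ≡ x
  φ-εᴾ x = proj₁ (proj₂ (proj₁ φ-isHom εᴾ))
    (trans (sym (φ-∙ᴾ εᴾ εᴾ x)) (cong (λ b → φ b x) (∙ᴾ-identityˡ εᴾ)))

  φ-zero : ∀ b → φ b zero ≡ zero
  φ-zero b with proj₂ (proj₂ (proj₁ φ-isHom b)) zero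
  ... | x , φb[x]≡0 = begin
    φ b zero                 ≡⟨ +ₙ-identityʳ (φ b zero) ⟨
    φ b zero +ₙ zero         ≡⟨ cong (φ b zero +ₙ_) (φb[x]≡0 refl) ⟨
    φ b zero +ₙ φ b x        ≡⟨ φ-+ₙ b zero x ⟨
    φ b (zero +ₙ x)          ≡⟨ cong (φ b) (+ₙ-identityˡ x) ⟩
    φ b x                    ≡⟨ φb[x]≡0 refl ⟩
    zero                     ∎
    where open ≡-Reasoning

  isMonoid : IsMonoid _≡_ _·_ (ι zero)
  isMonoid = record
    { isSemigroup = record
      { isMagma = record { isEquivalence = isEquivalence ; ∙-cong = cong₂ _·_ }
      ; assoc   = assoc
      }
    ; identity = identityˡ , identityʳ
    }
    where
    assoc : ∀ x y z → (x · y) · z ≡ x · (y · z)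
    assoc (a , b) (a′ , b′) (a″ , b″) = cong₂ _,_ (begin
      (a +ₙ φ b a′) +ₙ φ (b ∙ᴾ b′) a″       ≡⟨ +ₙ-assoc a (φ b a′) _ ⟩
      a +ₙ (φ b a′ +ₙ φ (b ∙ᴾ b′) a″)       ≡⟨ cong (λ t → a +ₙ (φ b a′ +ₙ t)) (φ-∙ᴾ b b′ a″) ⟩
      a +ₙ (φ b a′ +ₙ φ b (φ b′ a″))        ≡⟨ cong (a +ₙ_) (φ-+ₙ b a′ (φ b′ a″)) ⟨
      a +ₙ φ b (a′ +ₙ φ b′ a″)              ∎) (∙ᴾ-assoc b b′ b″)
      where open ≡-Reasoning
    identityˡ : ∀ x → ι zero · x ≡ x
    identityˡ (a , b) = cong₂ _,_ (trans (+ₙ-identityˡ (φ εᴾ a)) (φ-εᴾ a)) (∙ᴾ-identityˡ b)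
    identityʳ : ∀ x → x · ι zero ≡ x
    identityʳ (a , b) = cong₂ _,_ (trans (cong (a +ₙ_) (φ-zero b)) (+ₙ-identityʳ a)) (∙ᴾ-identityʳ b)

  open Powers isMonoid

  ι-×′ : ∀ r a → r ×′ ι a ≡ ι ((r * toℕ a) mod N)
  ι-×′ zero    a = refl
  ι-×′ (suc r) a = begin
    suc r ×′ ι a                            ≡⟨ 1+× r (ι a) ⟩
    ι a ∙ r ×′ ι a                          ≡⟨ cong (ι a ∙_) (ι-×′ r a) ⟩
    ι a ∙ ι ((r * toℕ a) mod N)             ≡⟨ cong₂ _,_ (cong (a +ₙ_) (φ-εᴾ _)) (∙ᴾ-identityˡ εᴾ) ⟩
    ι (a +ₙ ((r * toℕ a) mod N))            ≡⟨ cong ι (+ₙ-mod a r) ⟩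
    ι ((suc r * toℕ a) mod N)               ∎
    where open ≡-Reasoning

  proj₂-×′ : ∀ r g → proj₂ (r ×′ g) ≡ r ×ᴾ proj₂ g
  proj₂-×′ zero    g = refl
  proj₂-×′ (suc r) g = begin
    proj₂ (suc r ×′ g)              ≡⟨ cong proj₂ (1+× r g) ⟩
    proj₂ g ∙ᴾ proj₂ (r ×′ g)       ≡⟨ cong (proj₂ g ∙ᴾ_) (proj₂-×′ r g) ⟩
    proj₂ g ∙ᴾ (r ×ᴾ proj₂ g)       ≡⟨ 1+×ᴾ r (proj₂ g) ⟨
    suc r ×ᴾ proj₂ g                ∎
    where open ≡-Reasoning

  open PrimaryParts isMonoid

  isMultipleMod⇒∈⟨⟩ : ∀ {a b} → IsMultipleMod N (toℕ a) (toℕ b) → ι b ∈⟨ ι a ⟩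
  isMultipleMod⇒∈⟨⟩ {a} {b} (r , ra≡b) =
    r , sym (trans (ι-×′ r a) (cong ι (toℕ-injective
          (trans (toℕ-mod (r * toℕ a)) (trans ra≡b (toℕ%N b))))))

  module _ {p q : ℕ} (p-prime : Prime p) (q-prime : Prime q) (p≢q : p ≢ q)
           {n : ℕ} (P-enum : P ↔ Fin (p ^ n)) {s : ℕ} (N≡q^s : N ≡ q ^ s) where

    P-torsion : ∀ b → (p ^ suc n) ×ᴾ b ≡ εᴾ
    P-torsion b = begin
      (p * p ^ n) ×ᴾ b       ≡⟨ ×ᴾ-assocˡ b p (p ^ n) ⟨
      p ×ᴾ ((p ^ n) ×ᴾ b)    ≡⟨ cong (p ×ᴾ_) (card-annihilates P-isGroup P-enum b) ⟩
      p ×ᴾ εᴾ                ≡⟨ ×ᴾ-ε p ⟩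
      εᴾ                     ∎
      where open ≡-Reasoning

    pᵏ-power-∈ι : ∀ g → (p ^ suc n) ×′ g ≡ ι (proj₁ ((p ^ suc n) ×′ g))
    pᵏ-power-∈ι g = cong (proj₁ ((p ^ suc n) ×′ g) ,_)
      (trans (proj₂-×′ (p ^ suc n) g) (P-torsion (proj₂ g)))

    pᵏ-multiple-∈ι : ∀ t g → ∃ λ a → (t * p ^ suc n) ×′ g ≡ ι a
    pᵏ-multiple-∈ι t g = _ , (begin
      (t * p ^ suc n) ×′ g              ≡⟨ ×-assocˡ g t (p ^ suc n) ⟨
      t ×′ ((p ^ suc n) ×′ g)           ≡⟨ cong (t ×′_) (pᵏ-power-∈ι g) ⟩
      t ×′ ι (proj₁ ((p ^ suc n) ×′ g)) ≡⟨ ι-×′ t _ ⟩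
      ι _                               ∎)
      where open ≡-Reasoning

    exponent : ∀ g → (N * p ^ suc n) ×′ g ≡ ε
    exponent g = begin
      (N * p ^ suc n) ×′ g        ≡⟨ ×-assocˡ g N (p ^ suc n) ⟨
      N ×′ ((p ^ suc n) ×′ g)     ≡⟨ cong (N ×′_) (pᵏ-power-∈ι g) ⟩
      N ×′ ι a                    ≡⟨ ι-×′ N a ⟩
      ι ((N * toℕ a) mod N)       ≡⟨ cong ι ([N*x]modN≡0 (toℕ a)) ⟩
      ι zero                      ∎
      where
      open ≡-Reasoning
      a = proj₁ ((p ^ suc n) ×′ g)

    ι-chain : ∀ a b → ι b ∈⟨ ι a ⟩ ⊎ ι a ∈⟨ ι b ⟩
    ι-chain a b = Sum.map isMultipleMod⇒∈⟨⟩ isMultipleMod⇒∈⟨⟩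
      (isMultipleMod-total q-prime s N≡q^s (toℕ a) (toℕ b))

    N⊥pᵏ : Coprime N (p ^ suc n)
    N⊥pᵏ = subst (λ M → Coprime M (p ^ suc n)) (sym N≡q^s)
      (Coprimality.sym (coprime-^ (Coprimality.sym (coprime-^ q⊥p (suc n))) s))
      where q⊥p = distinct-primes⇒coprime q-prime p-prime (p≢q ∘ sym)

    -- w N ≡ 1 + j p ^ suc n by Bézout; modulo the exponent N p ^ suc n of G, w N and N₀ j p ^ suc n
    -- are the idempotents of the Chinese remainder theorem (≡ 1 and 0 mod p ^ suc n, 0 and 1 mod N).
    primaryDecomposition : PrimaryDecomposition p n
    primaryDecomposition with coprime⇒invertible N⊥pᵏ
    ... | w , j , wN≡1+jpᵏ = record
      { pExp          = w * N
      ; p′Exp         = N₀ * j * p ^ suc n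
      ; split         = split
      ; pPart-torsion = pPart-torsion
      ; p∣p′Exp       = ∣n⇒∣m*n (N₀ * j) (m∣m*n (p ^ n))
      ; p∤pExp        = p∣n⇒p∤1+j*n j p-prime (m∣m*n (p ^ n)) ∘ subst (p ∣_) wN≡1+jpᵏ
      ; p′Parts-chain = p′Parts-chain
      }
      where
      exponents-sum : N₀ * j * p ^ suc n + w * N ≡ 1 + j * (N * p ^ suc n)
      exponents-sum = begin
        N₀ * j * p ^ suc n + w * N             ≡⟨ cong (N₀ * j * p ^ suc n +_) wN≡1+jpᵏ ⟩
        N₀ * j * p ^ suc n + (1 + j * p ^ suc n) ≡⟨ rearrange N₀ j (p ^ suc n) ⟩
        1 + j * (N * p ^ suc n)                ∎
        where
        open ≡-Reasoning
        rearrange : ∀ N₀ j P → N₀ * j * P + (1 + j * P) ≡ 1 + j * (suc N₀ * P)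
        rearrange = solve-∀

      split : ∀ g → (N₀ * j * p ^ suc n) ×′ g ∙ (w * N) ×′ g ≡ g
      split g = begin
        (N₀ * j * p ^ suc n) ×′ g ∙ (w * N) ×′ g  ≡⟨ ×-homo-+ g (N₀ * j * p ^ suc n) (w * N) ⟨
        (N₀ * j * p ^ suc n + w * N) ×′ g        ≡⟨ cong (_×′ g) exponents-sum ⟩
        (1 + j * (N * p ^ suc n)) ×′ g           ≡⟨ ×-1+k*m j (exponent g) ⟩
        g                                        ∎
        where open ≡-Reasoning

      pPart-torsion : ∀ g → (p ^ suc n) ×′ ((w * N) ×′ g) ≡ ε
      pPart-torsion g = begin
        (p ^ suc n) ×′ ((w * N) ×′ g)  ≡⟨ ×-assocˡ g (p ^ suc n) (w * N) ⟩
        (p ^ suc n * (w * N)) ×′ g     ≡⟨ cong (_×′ g) (rearrange (p ^ suc n) w N) ⟩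
        (w * (N * p ^ suc n)) ×′ g     ≡⟨ ×-assocˡ g w (N * p ^ suc n) ⟨
        w ×′ ((N * p ^ suc n) ×′ g)    ≡⟨ cong (w ×′_) (exponent g) ⟩
        w ×′ ε                         ≡⟨ ×-ε w ⟩
        ε                              ∎
        where
        open ≡-Reasoning
        rearrange : ∀ P w N → P * (w * N) ≡ w * (N * P)
        rearrange = solve-∀

      p′Parts-chain : ∀ g h → (N₀ * j * p ^ suc n) ×′ h ∈⟨ (N₀ * j * p ^ suc n) ×′ g ⟩
                            ⊎ (N₀ * j * p ^ suc n) ×′ g ∈⟨ (N₀ * j * p ^ suc n) ×′ h ⟩
      p′Parts-chain g h with pᵏ-multiple-∈ι (N₀ * j) g | pᵏ-multiple-∈ι (N₀ * j) h
      ... | a , g′≡ιa | b , h′≡ιb rewrite g′≡ιa | h′≡ιb = ι-chain a b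

    G-enum : G ↔ Fin (N * p ^ n)
    G-enum = ↔-sym *↔× ↔-∘ (↔-refl ×-↔ P-enum)

    cliques : IsDisjointUnionOfCliques G (ExclPowAdj _·_ (_≡ p))
    cliques = decEquivalence⇒disjointUnionOfCliques G-enum
      (∼-isDecEquivalence _≟_ p-prime primaryDecomposition)
      λ g h g≢h → exclPower⇔∼ _≟_ p-prime primaryDecomposition g h ⇔-∘ exclPowAdj⇔exclPower g≢h
      where _≟_ = inj⇒≟ (↔⇒↣ G-enum)

lemma5p1 : (p q : ℕ) → Prime p → Prime q → p ≢ q →
    {P : Set} {_∙_ : Op₂ P} {ε : P} {_⁻¹ : Op₁ P} →
    IsGroup _≡_ _∙_ ε _⁻¹ →
    (∃ λ n → P ↔ Fin (p ^ n)) →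
    (s : ℕ) → (φ : P → Fin (q ^ s) → Fin (q ^ s)) → IsHomToAut _∙_ (q ^ s) φ →
    IsDisjointUnionOfCliques (SDP (q ^ s) P)
      (ExclPowAdj (sdpMul _∙_ φ) (_≡ p))
lemma5p1 p q p-prime q-prime p≢q {P} {_∙_} P-isGroup (n , P-enum) s = cliques-for (q ^ s) refl
  where
  -- _+ₙ_ computes only at a successor modulus, so q ^ s is generalised and split.
  cliques-for : ∀ N → N ≡ q ^ s → (φ : P → Fin N → Fin N) → IsHomToAut _∙_ N φ →
                IsDisjointUnionOfCliques (SDP N P) (ExclPowAdj (sdpMul _∙_ φ) (_≡ p))
  cliques-for zero     0≡q^s _ _ =
    contradiction (sym 0≡q^s) (≢-nonZero⁻¹ (q ^ s) {{m^n≢0 q s {{prime⇒nonZero q-prime}}}})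
  cliques-for (suc N₀) N≡q^s φ φ-isHom =
    SemidirectProduct.cliques P-isGroup N₀ φ φ-isHom p-prime q-prime p≢q {n} P-enum {s} N≡q^s
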